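{- Let $D$ be a bipartite tournament containing as a subdigraph a copy of the digraph $F$ with vertices $a,b,c,p,q$ and arcs $(a,p),(b,p),(b,q),(c,q),(p,c),(q,a)$ (an orientation of $K_{3,2}$ with parts $\{a,b,c\}$ and $\{p,q\}$). If $C_{1,2}(D)$ is connected and not isomorphic to $K_{1,4}$, then $C_{1,2}(D)$ contains two distinct triangles sharing an edge.
   Context: A bipartite tournament is an orientation of a complete bipartite graph $K_{m,n}$ ($m,n\ge1$). For vertices $x,y$ of a digraph $H$, $d_H(x,y)$ is the length of a shortest directed $(x,y)$-path. The $(1,2)$-step competition graph $C_{1,2}(D)$ is the simple graph on $V(D)$ in which distinct $u,v$ are adjacent iff there is $w\neq u,v$ with either $d_{D-v}(u,w)\le 1$ and $d_{D-u}(v,w)\le 2$, or $d_{D-u}(v,w)\le 1$ and $d_{D-v}(u,w)\le 2$. -}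

module Defs where

open import Data.Nat using (ℕ)
open import Data.Bool using (Bool; true; false)
open import Data.Fin using (Fin; zero)
open import Data.Product using (Σ; ∃; _×_; _,_)
open import Data.Sum using (_⊎_)
open import Relation.Nullary using (¬_)
open import Relation.Binary.PropositionalEquality using (_≡_; _≢_)
open import Relation.Binary.Construct.Closure.ReflexiveTransitive using (Star)
open import Function.Bundles using (_↔_; Inverse; _⇔_)

record BipTournament (n : ℕ) : Set where
  field
    side       : Fin n → Bool
    arc        : Fin n → Fin n → Bool
    part₁      : ∃ λ v → side v ≡ true
    part₂      : ∃ λ v → side v ≡ false
    arc-cross  : ∀ u v → arc u v ≡ true → side u ≢ side v
    arc-asym   : ∀ u v → arc u v ≡ true → arc v u ≡ false
    arc-total  : ∀ u v → side u ≢ side v → (arc u v ≡ true) ⊎ (arc v u ≡ true)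

module _ {n : ℕ} (D : BipTournament n) where
  open BipTournament D

  Arc : Fin n → Fin n → Set
  Arc u v = arc u v ≡ true

  -- d_{D - z}(u , w) ≤ 1   (u , w assumed distinct from z)
  Dist≤1 : (z u w : Fin n) → Set
  Dist≤1 z u w = (u ≡ w) ⊎ Arc u w

  -- d_{D - z}(u , w) ≤ 2   (u , w assumed distinct from z)
  Dist≤2 : (z u w : Fin n) → Set
  Dist≤2 z u w = (u ≡ w) ⊎ Arc u w ⊎ (∃ λ x → x ≢ z × Arc u x × Arc x w)

  C12Adj : Fin n → Fin n → Set
  C12Adj u v = u ≢ v × (∃ λ w → w ≢ u × w ≢ v ×
      ((Dist≤1 v u w × Dist≤2 u v w) ⊎ (Dist≤1 u v w × Dist≤2 v u w)))

  ContainsF : Set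
  ContainsF = ∃ λ a → ∃ λ b → ∃ λ c → ∃ λ p → ∃ λ q →
    (a ≢ b × a ≢ c × a ≢ p × a ≢ q × b ≢ c × b ≢ p × b ≢ q ×
     c ≢ p × c ≢ q × p ≢ q) ×
    (Arc a p × Arc b p × Arc b q × Arc c q × Arc p c × Arc q a)

Connected : {n : ℕ} → (Fin n → Fin n → Set) → Set
Connected {n} G = ∀ (u v : Fin n) → Star G u v

K14 : Fin 5 → Fin 5 → Set
K14 i j = (i ≡ zero × j ≢ zero) ⊎ (j ≡ zero × i ≢ zero)

IsoK14 : {n : ℕ} → (Fin n → Fin n → Set) → Set
IsoK14 {n} G = Σ (Fin n ↔ Fin 5) λ f →
  ∀ u v → G u v ⇔ K14 (Inverse.to f u) (Inverse.to f v)

TwoTrianglesSharingEdge : {n : ℕ} → (Fin n → Fin n → Set) → Set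
TwoTrianglesSharingEdge G = ∃ λ u → ∃ λ v → ∃ λ x → ∃ λ y →
  x ≢ y × G u v × G u x × G v x × G u y × G v y

-- If some vertex v of D lies outside the copy of F, then the part of v and the
-- orientation of its arcs to a and c (or to p and q) exhibit an explicit pair
-- of triangles of C₁,₂(D) on a common edge; of the eight cases, two are images
-- of others under the automorphism a ↔ c, p ↔ q of F.  Otherwise D is F itself:
-- each vertex u ≠ b has a unique out-neighbour w, whose only in-neighbours are
-- u and the source b, so every edge of C₁,₂(D) contains b, and C₁,₂(D) is the
-- star K₁,₄ centred at b.
module Submission where

open import Data.Bool using (Bool)
open import Data.Bool.Properties using (¬-not) renaming (_≟_ to _≟ᵇ_)
open import Data.Empty using (⊥-elim)
open import Data.Fin using (Fin; zero)
open import Data.Fin.Properties using (any?) renaming (_≟_ to _≟ᶠ_)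
open import Data.Nat using (ℕ)
open import Data.Product using (∃; _×_; _,_; proj₁)
open import Data.Product.Function.NonDependent.Propositional using (_×-⇔_)
open import Data.Sum using (_⊎_; inj₁; inj₂; swap)
open import Data.Sum.Function.Propositional using (_⊎-⇔_)
open import Data.Vec using (Vec; []; _∷_; lookup)
open import Data.Vec.Membership.Propositional using (_∈_; _∉_)
open import Data.Vec.Relation.Unary.All using ([]; _∷_)
open import Data.Vec.Relation.Unary.AllPairs using ([]; _∷_)
open import Data.Vec.Relation.Unary.Any as Any using (here; there; index)
open import Data.Vec.Relation.Unary.Any.Properties using (lookup-index)
open import Data.Vec.Relation.Unary.Unique.Propositional using (Unique)
open import Data.Vec.Relation.Unary.Unique.Propositional.Properties using (lookup-injective)
open import Function.Bundles using (_↔_; _⇔_; Inverse; mk⇔; mk↔ₛ′)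
open import Function.Properties.Equivalence using () renaming (trans to ⇔-trans)
open import Function.Related.TypeIsomorphisms using (¬-cong-⇔)
open import Relation.Nullary using (¬_; yes; no)
open import Relation.Nullary.Decidable using (¬?; decidable-stable)
open import Relation.Binary.PropositionalEquality
  using (_≡_; _≢_; refl; sym; trans; subst; ≢-sym)

open import Defs

≢-≢⇒≡ : {x y z : Bool} → x ≢ z → y ≢ z → x ≡ y
≢-≢⇒≡ x≢z y≢z = trans (¬-not x≢z) (sym (¬-not y≢z))

StarAt : {A : Set} → A → A → A → Set
StarAt z u v = (u ≡ z × v ≢ z) ⊎ (v ≡ z × u ≢ z)

enumeration⇒↔ : {A : Set} {k : ℕ} {xs : Vec A k} →
  Unique xs → (∀ x → x ∈ xs) → A ↔ Fin k
enumeration⇒↔ {xs = xs} unique enum =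
  mk↔ₛ′ (λ x → index (enum x)) (lookup xs) index-lookup lookup-index′
  where
  lookup-index′ : ∀ x → lookup xs (index (enum x)) ≡ x
  lookup-index′ x = sym (lookup-index (enum x))
  index-lookup : ∀ i → index (enum (lookup xs i)) ≡ i
  index-lookup i = lookup-injective unique _ _ (lookup-index′ (lookup xs i))

star⇒IsoK14 : {n : ℕ} {G : Fin n → Fin n → Set} (f : Fin n ↔ Fin 5) →
  (∀ u v → G u v ⇔ StarAt (Inverse.from f zero) u v) → IsoK14 G
star⇒IsoK14 f star = f , λ u v →
  ⇔-trans (star u v)
    (centre⇔ u ×-⇔ ¬-cong-⇔ (centre⇔ v) ⊎-⇔ centre⇔ v ×-⇔ ¬-cong-⇔ (centre⇔ u))
  where
  open Inverse f
  centre⇔ : ∀ u → (u ≡ from zero) ⇔ (to u ≡ zero)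
  centre⇔ u = mk⇔ inverseˡ (λ eq → sym (inverseʳ (sym eq)))

two-triangles : {n : ℕ} {G : Fin n → Fin n → Set} (u v x y : Fin n) → x ≢ y →
  G u v → G u x → G v x → G u y → G v y → TwoTrianglesSharingEdge G
two-triangles u v x y x≢y uv ux vx uy vy = u , v , x , y , x≢y , uv , ux , vx , uy , vy

module TournamentProperties {n : ℕ} (D : BipTournament n) where
  open BipTournament D

  arc⇒≢ : ∀ {u v} → Arc D u v → u ≢ v
  arc⇒≢ {u} u→v refl = arc-cross u u u→v refl

  arc⇒¬arc : ∀ {u v} → Arc D u v → ¬ Arc D v u
  arc⇒¬arc {u} {v} u→v v→u with trans (sym v→u) (arc-asym u v u→v)
  ... | ()

  adj-sym : ∀ {u v} → C12Adj D u v → C12Adj D v u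
  adj-sym (u≢v , w , w≢u , w≢v , inj₁ steps) = ≢-sym u≢v , w , w≢v , w≢u , inj₂ steps
  adj-sym (u≢v , w , w≢u , w≢v , inj₂ steps) = ≢-sym u≢v , w , w≢v , w≢u , inj₁ steps

  common-out⇒adj : ∀ {u v w} → Arc D u w → Arc D v w → u ≢ v → C12Adj D u v
  common-out⇒adj u→w v→w u≢v =
    u≢v , _ , ≢-sym (arc⇒≢ u→w) , ≢-sym (arc⇒≢ v→w) ,
    inj₁ (inj₂ u→w , inj₂ (inj₁ v→w))

  two-step⇒adj : ∀ {u v w x} → Arc D u w → Arc D v x → Arc D x w → x ≢ u → C12Adj D u v
  two-step⇒adj {u} {v} {w} {x} u→w v→x x→w x≢u =
    u≢v , w , ≢-sym (arc⇒≢ u→w) , w≢v ,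
    inj₁ (inj₂ u→w , inj₂ (inj₂ (x , x≢u , v→x , x→w)))
    where
    w≢v : w ≢ v
    w≢v refl = arc⇒¬arc v→x x→w
    -- u → w and u → x → w would give u, x, w three pairwise different sides.
    u≢v : u ≢ v
    u≢v refl =
      arc-cross u w u→w (≢-≢⇒≡ (arc-cross u x v→x) (≢-sym (arc-cross x w x→w)))

  dist≤2⇒source : ∀ {u v w b} →
    (∀ {x} → Arc D x w → x ≡ u ⊎ x ≡ b) → (∀ {x} → ¬ Arc D x b) →
    v ≢ u → w ≢ v → Dist≤2 D u v w → v ≡ b
  dist≤2⇒source _ _ _ w≢v (inj₁ v≡w) = ⊥-elim (w≢v (sym v≡w))
  dist≤2⇒source in-w _ v≢u _ (inj₂ (inj₁ v→w)) with in-w v→w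
  ... | inj₁ v≡u = ⊥-elim (v≢u v≡u)
  ... | inj₂ v≡b = v≡b
  dist≤2⇒source in-w no-in-b _ _ (inj₂ (inj₂ (x , x≢u , v→x , x→w))) with in-w x→w
  ... | inj₁ x≡u = ⊥-elim (x≢u x≡u)
  ... | inj₂ refl = ⊥-elim (no-in-b v→x)

-- Vertices in different parts need no distinctness field: they are joined by arcs.
record FCopy {n : ℕ} (D : BipTournament n) : Set where
  field
    a b c p q : Fin n
    a≢b : a ≢ b
    a≢c : a ≢ c
    b≢c : b ≢ c
    p≢q : p ≢ q
    a→p : Arc D a p
    b→p : Arc D b p
    b→q : Arc D b q
    c→q : Arc D c q
    p→c : Arc D p c
    q→a : Arc D q a

  -- b comes first so that it is sent to the centre zero of K₁,₄.
  vertices : Vec (Fin n) 5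
  vertices = b ∷ a ∷ c ∷ p ∷ q ∷ []

module _ {n : ℕ} {D : BipTournament n} where

  containsF⇒FCopy : ContainsF D → FCopy D
  containsF⇒FCopy (a , b , c , p , q , (a≢b , a≢c , _ , _ , b≢c , _ , _ , _ , _ , p≢q) ,
                   (a→p , b→p , b→q , c→q , p→c , q→a)) =
    record { a = a ; b = b ; c = c ; p = p ; q = q
           ; a≢b = a≢b ; a≢c = a≢c ; b≢c = b≢c ; p≢q = p≢q
           ; a→p = a→p ; b→p = b→p ; b→q = b→q ; c→q = c→q ; p→c = p→c ; q→a = q→a }

  swapFCopy : FCopy D → FCopy D
  swapFCopy F = record
    { a = c ; b = b ; c = a ; p = q ; q = p
    ; a≢b = ≢-sym b≢c ; a≢c = ≢-sym a≢c ; b≢c = ≢-sym a≢b ; p≢q = ≢-sym p≢q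
    ; a→p = c→q ; b→p = b→q ; b→q = b→p ; c→q = a→p ; p→c = q→a ; q→a = p→c }
    where open FCopy F

module FCopyProperties {n : ℕ} {D : BipTournament n} (F : FCopy D) where
  open BipTournament D
  open TournamentProperties D
  open FCopy F

  side-b≡a : side b ≡ side a
  side-b≡a = ≢-≢⇒≡ (arc-cross b p b→p) (arc-cross a p a→p)

  side-c≡a : side c ≡ side a
  side-c≡a = ≢-≢⇒≡ (≢-sym (arc-cross p c p→c)) (arc-cross a p a→p)

  side-q≡p : side q ≡ side p
  side-q≡p = ≢-≢⇒≡ (arc-cross q a q→a) (≢-sym (arc-cross a p a→p))

  b-adj-a : C12Adj D b a
  b-adj-a = common-out⇒adj b→p a→p (≢-sym a≢b)

  b-adj-c : C12Adj D b c
  b-adj-c = common-out⇒adj b→q c→q b≢c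

  b-adj-p : C12Adj D b p
  b-adj-p = two-step⇒adj b→q p→c c→q (≢-sym b≢c)

  b-adj-q : C12Adj D b q
  b-adj-q = two-step⇒adj b→p q→a a→p a≢b

  vertices-unique : Unique vertices
  vertices-unique =
    (≢-sym a≢b ∷ b≢c ∷ arc⇒≢ b→p ∷ arc⇒≢ b→q ∷ []) ∷
    (a≢c ∷ arc⇒≢ a→p ∷ ≢-sym (arc⇒≢ q→a) ∷ []) ∷
    (≢-sym (arc⇒≢ p→c) ∷ arc⇒≢ c→q ∷ []) ∷
    (p≢q ∷ []) ∷ [] ∷ []

  two-triangles-a→v-c→v : ∀ {v} → Arc D a v → Arc D c v →
    TwoTrianglesSharingEdge (C12Adj D)
  two-triangles-a→v-c→v a→v c→v =
    two-triangles a b c p (≢-sym (arc⇒≢ p→c))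
      (adj-sym b-adj-a) (common-out⇒adj a→v c→v a≢c) b-adj-c
      (two-step⇒adj a→v p→c c→v (≢-sym a≢c)) b-adj-p

  two-triangles-a→v→c : ∀ {v} → Arc D a v → Arc D v c → v ≢ b → v ≢ p →
    TwoTrianglesSharingEdge (C12Adj D)
  two-triangles-a→v→c {v} a→v v→c v≢b v≢p =
    two-triangles a p b v (≢-sym v≢b)
      (adj-sym (two-step⇒adj p→c a→v v→c v≢p)) (adj-sym b-adj-a) (adj-sym b-adj-p)
      (adj-sym (two-step⇒adj v→c a→p p→c (≢-sym v≢p))) (common-out⇒adj p→c v→c (≢-sym v≢p))

  two-triangles-v→a-v→c : ∀ {v} → Arc D v a → Arc D v c → v ≢ p → v ≢ q →
    TwoTrianglesSharingEdge (C12Adj D)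
  two-triangles-v→a-v→c {v} v→a v→c v≢p v≢q =
    two-triangles v b a c a≢c
      v-adj-b (two-step⇒adj v→c a→p p→c (≢-sym v≢p)) b-adj-a
      (two-step⇒adj v→a c→q q→a (≢-sym v≢q)) b-adj-c
    where
    v-adj-b : C12Adj D v b
    v-adj-b with arc-total b v (λ eq → arc-cross v a v→a (trans (sym eq) side-b≡a))
    ... | inj₁ b→v = adj-sym (two-step⇒adj b→p v→a a→p a≢b)
    ... | inj₂ v→b = two-step⇒adj v→a b→q q→a (≢-sym v≢q)

  two-triangles-p→v-q→v : ∀ {v} → Arc D p v → Arc D q v →
    TwoTrianglesSharingEdge (C12Adj D)
  two-triangles-p→v-q→v p→v q→v =
    two-triangles b q p a (≢-sym (arc⇒≢ a→p))
      b-adj-q b-adj-p (common-out⇒adj q→v p→v (≢-sym p≢q))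
      b-adj-a (two-step⇒adj q→v a→p p→v p≢q)

  two-triangles-p→v→q : ∀ {v} → Arc D p v → Arc D v q → v ≢ b → v ≢ c →
    TwoTrianglesSharingEdge (C12Adj D)
  two-triangles-p→v→q {v} p→v v→q v≢b v≢c =
    two-triangles b v c p (≢-sym (arc⇒≢ p→c))
      (common-out⇒adj b→q v→q (≢-sym v≢b)) b-adj-c (common-out⇒adj v→q c→q v≢c)
      b-adj-p (two-step⇒adj v→q p→c c→q (≢-sym v≢c))

  two-triangles-v→p-v→q : ∀ {v} → Arc D v p → Arc D v q → v ≢ a → v ≢ b → v ≢ c →
    TwoTrianglesSharingEdge (C12Adj D)
  two-triangles-v→p-v→q {v} v→p v→q v≢a v≢b v≢c =
    two-triangles b v a c a≢c
      (common-out⇒adj b→p v→p (≢-sym v≢b)) b-adj-a (common-out⇒adj v→p a→p v≢a)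
      b-adj-c (common-out⇒adj v→q c→q v≢c)

module _ {n : ℕ} {D : BipTournament n} (F : FCopy D) where
  open BipTournament D
  open FCopy F
  open FCopyProperties F
  private
    module Swapped = FCopyProperties (swapFCopy F)

  module _ {v : Fin n} (v∉ : v ∉ vertices) where
    private
      v≢b : v ≢ b
      v≢b refl = v∉ (here refl)
      v≢a : v ≢ a
      v≢a refl = v∉ (there (here refl))
      v≢c : v ≢ c
      v≢c refl = v∉ (there (there (here refl)))
      v≢p : v ≢ p
      v≢p refl = v∉ (there (there (there (here refl))))
      v≢q : v ≢ q
      v≢q refl = v∉ (there (there (there (there (here refl)))))

    two-triangles-by-arcs-to-a-c : Arc D a v ⊎ Arc D v a → Arc D c v ⊎ Arc D v c →
      TwoTrianglesSharingEdge (C12Adj D)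
    two-triangles-by-arcs-to-a-c (inj₁ a→v) (inj₁ c→v) = two-triangles-a→v-c→v a→v c→v
    two-triangles-by-arcs-to-a-c (inj₁ a→v) (inj₂ v→c) = two-triangles-a→v→c a→v v→c v≢b v≢p
    two-triangles-by-arcs-to-a-c (inj₂ v→a) (inj₁ c→v) = Swapped.two-triangles-a→v→c c→v v→a v≢b v≢q
    two-triangles-by-arcs-to-a-c (inj₂ v→a) (inj₂ v→c) = two-triangles-v→a-v→c v→a v→c v≢p v≢q

    two-triangles-by-arcs-to-p-q : Arc D p v ⊎ Arc D v p → Arc D q v ⊎ Arc D v q →
      TwoTrianglesSharingEdge (C12Adj D)
    two-triangles-by-arcs-to-p-q (inj₁ p→v) (inj₁ q→v) = two-triangles-p→v-q→v p→v q→v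
    two-triangles-by-arcs-to-p-q (inj₁ p→v) (inj₂ v→q) = two-triangles-p→v→q p→v v→q v≢b v≢c
    two-triangles-by-arcs-to-p-q (inj₂ v→p) (inj₁ q→v) = Swapped.two-triangles-p→v→q q→v v→p v≢b v≢a
    two-triangles-by-arcs-to-p-q (inj₂ v→p) (inj₂ v→q) = two-triangles-v→p-v→q v→p v→q v≢a v≢b v≢c

    outside⇒two-triangles : TwoTrianglesSharingEdge (C12Adj D)
    outside⇒two-triangles with side v ≟ᵇ side p
    ... | yes v~p = two-triangles-by-arcs-to-a-c
      (arc-total a v (subst (side a ≢_) (sym v~p) (arc-cross a p a→p)))
      (arc-total c v (subst (side c ≢_) (sym v~p) (≢-sym (arc-cross p c p→c))))
    ... | no v≁p = two-triangles-by-arcs-to-p-q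
      (arc-total p v (≢-sym v≁p))
      (arc-total q v (subst (_≢ side v) (sym side-q≡p) (≢-sym v≁p)))

  outside-or-covers : (∃ λ v → v ∉ vertices) ⊎ (∀ u → u ∈ vertices)
  outside-or-covers with any? (λ v → ¬? (Any.any? (v ≟ᶠ_) vertices))
  ... | yes outside = inj₁ outside
  ... | no ¬outside =
    inj₂ λ u → decidable-stable (Any.any? (u ≟ᶠ_) vertices) (λ u∉ → ¬outside (u , u∉))

module Covering {n : ℕ} {D : BipTournament n} (F : FCopy D)
                (covers : ∀ u → u ∈ FCopy.vertices F) where
  open BipTournament D
  open TournamentProperties D
  open FCopy F
  open FCopyProperties F

  opposite-a : ∀ {x} → side x ≢ side a → x ≡ p ⊎ x ≡ q
  opposite-a {x} x≁a with covers x
  ... | here refl = ⊥-elim (x≁a side-b≡a)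
  ... | there (here refl) = ⊥-elim (x≁a refl)
  ... | there (there (here refl)) = ⊥-elim (x≁a side-c≡a)
  ... | there (there (there (here refl))) = inj₁ refl
  ... | there (there (there (there (here refl)))) = inj₂ refl

  opposite-p : ∀ {x} → side x ≢ side p → x ≡ a ⊎ x ≡ b ⊎ x ≡ c
  opposite-p {x} x≁p with covers x
  ... | here refl = inj₂ (inj₁ refl)
  ... | there (here refl) = inj₁ refl
  ... | there (there (here refl)) = inj₂ (inj₂ refl)
  ... | there (there (there (here refl))) = ⊥-elim (x≁p refl)
  ... | there (there (there (there (here refl)))) = ⊥-elim (x≁p side-q≡p)

  b-is-source : ∀ {x} → ¬ Arc D x b
  b-is-source x→b with opposite-a (subst (side _ ≢_) side-b≡a (arc-cross _ b x→b))
  ... | inj₁ refl = arc⇒¬arc b→p x→b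
  ... | inj₂ refl = arc⇒¬arc b→q x→b

  OnlyCompetitorIsB : Fin n → Set
  OnlyCompetitorIsB u = ∀ {w} → Arc D u w → ∀ {x} → Arc D x w → x ≡ u ⊎ x ≡ b

  competitors-a : OnlyCompetitorIsB a
  competitors-a a→w x→w with opposite-a (≢-sym (arc-cross a _ a→w))
  ... | inj₂ refl = ⊥-elim (arc⇒¬arc q→a a→w)
  ... | inj₁ refl with opposite-p (arc-cross _ p x→w)
  ...   | inj₁ refl = inj₁ refl
  ...   | inj₂ (inj₁ refl) = inj₂ refl
  ...   | inj₂ (inj₂ refl) = ⊥-elim (arc⇒¬arc p→c x→w)

  competitors-c : OnlyCompetitorIsB c
  competitors-c c→w x→w with opposite-a (subst (side _ ≢_) side-c≡a (≢-sym (arc-cross c _ c→w)))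
  ... | inj₁ refl = ⊥-elim (arc⇒¬arc p→c c→w)
  ... | inj₂ refl with opposite-p (subst (side _ ≢_) side-q≡p (arc-cross _ q x→w))
  ...   | inj₁ refl = ⊥-elim (arc⇒¬arc q→a x→w)
  ...   | inj₂ (inj₁ refl) = inj₂ refl
  ...   | inj₂ (inj₂ refl) = inj₁ refl

  competitors-p : OnlyCompetitorIsB p
  competitors-p p→w x→w with opposite-p (≢-sym (arc-cross p _ p→w))
  ... | inj₁ refl = ⊥-elim (arc⇒¬arc a→p p→w)
  ... | inj₂ (inj₁ refl) = ⊥-elim (arc⇒¬arc b→p p→w)
  ... | inj₂ (inj₂ refl) with opposite-a (subst (side _ ≢_) side-c≡a (arc-cross _ c x→w))
  ...   | inj₁ refl = inj₁ refl
  ...   | inj₂ refl = ⊥-elim (arc⇒¬arc c→q x→w)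

  competitors-q : OnlyCompetitorIsB q
  competitors-q q→w x→w with opposite-p (subst (side _ ≢_) side-q≡p (≢-sym (arc-cross q _ q→w)))
  ... | inj₂ (inj₁ refl) = ⊥-elim (arc⇒¬arc b→q q→w)
  ... | inj₂ (inj₂ refl) = ⊥-elim (arc⇒¬arc c→q q→w)
  ... | inj₁ refl with opposite-a (arc-cross _ a x→w)
  ...   | inj₁ refl = ⊥-elim (arc⇒¬arc a→p x→w)
  ...   | inj₂ refl = inj₁ refl

  competitors : ∀ {u} → u ≢ b → OnlyCompetitorIsB u
  competitors {u} u≢b with covers u
  ... | here refl = ⊥-elim (u≢b refl)
  ... | there (here refl) = competitors-a
  ... | there (there (here refl)) = competitors-c
  ... | there (there (there (here refl))) = competitors-p
  ... | there (there (there (there (here refl)))) = competitors-q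

  steps⇒incident-b : ∀ {u v w} → u ≢ v → w ≢ u → w ≢ v →
    Dist≤1 D v u w → Dist≤2 D u v w → u ≡ b ⊎ v ≡ b
  steps⇒incident-b _ w≢u _ (inj₁ u≡w) _ = ⊥-elim (w≢u (sym u≡w))
  steps⇒incident-b {u} u≢v w≢u w≢v (inj₂ u→w) reach with u ≟ᶠ b
  ... | yes u≡b = inj₁ u≡b
  ... | no u≢b =
    inj₂ (dist≤2⇒source (competitors u≢b u→w) b-is-source (≢-sym u≢v) w≢v reach)

  adj⇒incident-b : ∀ {u v} → C12Adj D u v → u ≡ b ⊎ v ≡ b
  adj⇒incident-b (u≢v , w , w≢u , w≢v , inj₁ (u⇢w , reach)) =
    steps⇒incident-b u≢v w≢u w≢v u⇢w reach
  adj⇒incident-b (u≢v , w , w≢u , w≢v , inj₂ (v⇢w , reach)) =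
    swap (steps⇒incident-b (≢-sym u≢v) w≢v w≢u v⇢w reach)

  b-adj : ∀ {v} → v ≢ b → C12Adj D b v
  b-adj {v} v≢b with covers v
  ... | here refl = ⊥-elim (v≢b refl)
  ... | there (here refl) = b-adj-a
  ... | there (there (here refl)) = b-adj-c
  ... | there (there (there (here refl))) = b-adj-p
  ... | there (there (there (there (here refl)))) = b-adj-q

  C12-star : ∀ u v → C12Adj D u v ⇔ StarAt b u v
  C12-star u v = mk⇔ to from
    where
    to : C12Adj D u v → StarAt b u v
    to adj with adj⇒incident-b adj
    ... | inj₁ u≡b = inj₁ (u≡b , λ v≡b → proj₁ adj (trans u≡b (sym v≡b)))
    ... | inj₂ v≡b = inj₂ (v≡b , λ u≡b → proj₁ adj (trans u≡b (sym v≡b)))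
    from : ∀ {u v} → StarAt b u v → C12Adj D u v
    from (inj₁ (refl , v≢b)) = b-adj v≢b
    from (inj₂ (refl , u≢b)) = adj-sym (b-adj u≢b)

  C12-isoK14 : IsoK14 (C12Adj D)
  C12-isoK14 = star⇒IsoK14 (enumeration⇒↔ vertices-unique covers) C12-star

FCopy⇒two-triangles-or-IsoK14 : {n : ℕ} {D : BipTournament n} → FCopy D →
  TwoTrianglesSharingEdge (C12Adj D) ⊎ IsoK14 (C12Adj D)
FCopy⇒two-triangles-or-IsoK14 F with outside-or-covers F
... | inj₁ (v , v∉) = inj₁ (outside⇒two-triangles F v∉)
... | inj₂ covers = inj₂ (Covering.C12-isoK14 F covers)

lemma3p6 : (n : ℕ) (D : BipTournament n) → ContainsF D →
    Connected (C12Adj D) → ¬ IsoK14 (C12Adj D) →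
    TwoTrianglesSharingEdge (C12Adj D)
lemma3p6 n D containsF _ not-K14
  with FCopy⇒two-triangles-or-IsoK14 (containsF⇒FCopy {D = D} containsF)
... | inj₁ triangles = triangles
... | inj₂ iso = ⊥-elim (not-K14 iso)
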